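{- Let $x\geqslant y\geqslant 2$ be integers with $x=y+1$. Let $P$ be the interval order on $x+y$ elements represented by the open intervals $((j-1)/x,\,j/x)$ for $j=1,\dots,x$ and $((j-1)/y,\,j/y)$ for $j=1,\dots,y$, where one element is strictly below another if and only if the right endpoint of the first interval is at most the left endpoint of the second. Then the incomparability graph of $P$ is a path with an odd number of vertices. -}

module Defs where

open import Data.Nat using (ℕ; suc; _+_; _*_; NonZero)
open import Data.Fin using (Fin; toℕ)
open import Data.Sum using (_⊎_; inj₁; inj₂)
open import Data.Product using (Σ; ∃; _×_)
open import Data.Integer using (+_)
open import Data.Rational.Unnormalised using (ℚᵘ; _/_; _≤_)
open import Relation.Binary.PropositionalEquality using (_≡_; _≢_)
open import Relation.Nullary using (¬_)
open import Function.Bundles using (_⤖_; _⇔_; Bijection)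

Odd : ℕ → Set
Odd n = ∃ λ k → n ≡ suc (2 * k)

record Interval : Set where
  constructor ⟨_,_⟩
  field
    left  : ℚᵘ
    right : ℚᵘ
open Interval public

-- ground set of P: x + y elements, the first family indexed by Fin x,
-- the second by Fin y (index j : Fin stands for j+1 in the paper)
Elem : ℕ → ℕ → Set
Elem x y = Fin x ⊎ Fin y

interval : (x y : ℕ) .{{_ : NonZero x}} .{{_ : NonZero y}} → Elem x y → Interval
interval x y (inj₁ i) = ⟨ (+ toℕ i) / x , (+ suc (toℕ i)) / x ⟩
interval x y (inj₂ i) = ⟨ (+ toℕ i) / y , (+ suc (toℕ i)) / y ⟩

Below : (x y : ℕ) .{{_ : NonZero x}} .{{_ : NonZero y}} → Elem x y → Elem x y → Set
Below x y u v = right (interval x y u) ≤ left (interval x y v)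

IncompEdge : (x y : ℕ) .{{_ : NonZero x}} .{{_ : NonZero y}} → Elem x y → Elem x y → Set
IncompEdge x y u v = u ≢ v × ¬ Below x y u v × ¬ Below x y v u

PathAdj : {n : ℕ} → Fin n → Fin n → Set
PathAdj i j = (suc (toℕ i) ≡ toℕ j) ⊎ (suc (toℕ j) ≡ toℕ i)

IsPathOn : {V : Set} → ℕ → (V → V → Set) → Set
IsPathOn {V} n E = Σ (Fin n ⤖ V) λ f →
  ∀ i j → E (Bijection.to f i) (Bijection.to f j) ⇔ PathAdj i j

module Submission where

-- Write A₀,…,A_y for the intervals of length 1/(y+1) and
-- B₀,…,B_{y-1} for those of length 1/y.  Two intervals of the same family
-- are disjoint, so distinct elements of one family are comparable.  For
-- the cross pairs, clearing denominators turns the order relation into an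
-- inequality of natural numbers, which (using x = y + 1) reduces to
--   Aᵢ < Bⱼ  iff  i < j,      Bⱼ < Aᵢ  iff  j + 1 < i,
-- so Aᵢ and Bⱼ are incomparable exactly when i = j or i = j + 1.  Labelling
-- Aᵢ by 2i and Bⱼ by 2j+1 is therefore a bijection onto {0,…,2y} under
-- which incomparability means "labels differ by one": the incomparability
-- graph is the path A₀ B₀ A₁ B₁ … B_{y-1} A_y on 2y+1 vertices.

open import Defs
open import Data.Nat using (ℕ; zero; suc; _+_; _*_; _≤_; _<_; NonZero; z≤n; s≤s)
open import Data.Nat.Properties
open import Data.Product using (∃; _×_; _,_)
open import Data.Sum using (_⊎_; inj₁; inj₂; [_,_]′)
open import Data.Fin using (Fin; toℕ; fromℕ<)
open import Data.Fin.Properties using (toℕ-fromℕ<; toℕ-injective; toℕ<n)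
open import Data.Empty using (⊥-elim)
open import Data.Integer as ℤ using (+_; +≤+)
open import Data.Integer.Properties using (pos-*)
open import Data.Rational.Unnormalised as ℚ using (*≤*)
open import Relation.Binary.PropositionalEquality
open import Relation.Binary using (tri<; tri≈; tri>)
open import Relation.Nullary using (¬_; contradiction)
open import Function using (_∘_)
open import Function.Bundles using (_⇔_; mk⇔; mk↔ₛ′; Equivalence)
open import Function.Properties.Inverse using (↔⇒⤖)
import Function.Properties.Equivalence as ⇔

open Equivalence using (to; from)

-- Two numbers are consecutive when they differ by exactly one; this is the
-- adjacency of the path graph on labels (`PathAdj i j` unfolds to
-- `Consecutive (toℕ i) (toℕ j)`).
Consecutive : ℕ → ℕ → Set
Consecutive a b = (suc a ≡ b) ⊎ (suc b ≡ a)

Consecutive-sym : ∀ {a b} → Consecutive a b → Consecutive b a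
Consecutive-sym (inj₁ e) = inj₂ e
Consecutive-sym (inj₂ e) = inj₁ e

record PathLabelling {V : Set} (n : ℕ) (E : V → V → Set) : Set where
  field
    label           : V → ℕ
    label<n         : ∀ v → label v < n
    label-injective : ∀ u v → label u ≡ label v → u ≡ v
    unlabel         : ∀ m → m < n → V
    label-unlabel   : ∀ m (m<n : m < n) → label (unlabel m m<n) ≡ m
    adjacency       : ∀ u v → E u v ⇔ Consecutive (label u) (label v)

labelling⇒path : ∀ {V : Set} {n : ℕ} {E : V → V → Set} → PathLabelling n E → IsPathOn n E
labelling⇒path {V} {n} {E} L = ↔⇒⤖ (mk↔ₛ′ vertex index vertex-index index-vertex) , adjacent
  where
  open PathLabelling L

  vertex : Fin n → V
  vertex a = unlabel (toℕ a) (toℕ<n a)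

  index : V → Fin n
  index v = fromℕ< (label<n v)

  label-vertex : ∀ a → label (vertex a) ≡ toℕ a
  label-vertex a = label-unlabel (toℕ a) (toℕ<n a)

  vertex-index : ∀ v → vertex (index v) ≡ v
  vertex-index v = label-injective _ v (trans (label-vertex (index v)) (toℕ-fromℕ< (label<n v)))

  index-vertex : ∀ a → index (vertex a) ≡ a
  index-vertex a = toℕ-injective (trans (toℕ-fromℕ< (label<n (vertex a))) (label-vertex a))

  adjacent : ∀ a b → E (vertex a) (vertex b) ⇔ PathAdj a b
  adjacent a b = subst₂ (λ p q → E (vertex a) (vertex b) ⇔ Consecutive p q)
                        (label-vertex a) (label-vertex b) (adjacency (vertex a) (vertex b))

fraction-≤ : ∀ a b d e .{{_ : NonZero d}} .{{_ : NonZero e}} →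
             (+ a ℚ./ d) ℚ.≤ (+ b ℚ./ e) ⇔ (a * e ≤ b * d)
fraction-≤ a b (suc d) (suc e) = mk⇔ cleared fractional
  where
  cleared : (+ a ℚ./ suc d) ℚ.≤ (+ b ℚ./ suc e) → a * suc e ≤ b * suc d
  cleared (*≤* p) with subst₂ ℤ._≤_ (sym (pos-* a (suc e))) (sym (pos-* b (suc d))) p
  ... | +≤+ q = q
  fractional : a * suc e ≤ b * suc d → (+ a ℚ./ suc d) ℚ.≤ (+ b ℚ./ suc e)
  fractional q = *≤* (subst₂ ℤ._≤_ (pos-* a (suc e)) (pos-* b (suc d)) (+≤+ q))

grid-comparable : ∀ k .{{_ : NonZero k}} (i j : Fin k) → i ≢ j →
                  ((+ suc (toℕ i) ℚ./ k) ℚ.≤ (+ toℕ j ℚ./ k)) ⊎ ((+ suc (toℕ j) ℚ./ k) ℚ.≤ (+ toℕ i ℚ./ k))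
grid-comparable k i j i≢j with <-cmp (toℕ i) (toℕ j)
... | tri< i<j _ _ = inj₁ (from (fraction-≤ (suc (toℕ i)) (toℕ j) k k) (*-monoˡ-≤ k i<j))
... | tri≈ _ i≡j _ = contradiction (toℕ-injective i≡j) i≢j
... | tri> _ _ j<i = inj₂ (from (fraction-≤ (suc (toℕ j)) (toℕ i) k k) (*-monoˡ-≤ k j<i))

module _ (x y : ℕ) .{{_ : NonZero x}} .{{_ : NonZero y}} where

  incomparable-sym : ∀ u v → IncompEdge x y u v ⇔ IncompEdge x y v u
  incomparable-sym u v = mk⇔ swap swap
    where
    swap : ∀ {p q} → IncompEdge x y p q → IncompEdge x y q p
    swap (p≢q , p≮q , q≮p) = p≢q ∘ sym , q≮p , p≮q

  first-family-comparable : ∀ i i′ → ¬ IncompEdge x y (inj₁ i) (inj₁ i′)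
  first-family-comparable i i′ (ne , ≮ , ≯) =
    [ ≮ , ≯ ]′ (grid-comparable x i i′ (ne ∘ cong inj₁))

  second-family-comparable : ∀ j j′ → ¬ IncompEdge x y (inj₂ j) (inj₂ j′)
  second-family-comparable j j′ (ne , ≮ , ≯) =
    [ ≮ , ≯ ]′ (grid-comparable y j j′ (ne ∘ cong inj₂))

*-+1 : ∀ m y → m * (y + 1) ≡ m * y + m
*-+1 m y = trans (*-distribˡ-+ m y 1) (cong (_+_ (m * y)) (*-identityʳ m))

left-of-second : ∀ i j y → j < y → (suc i * y ≤ j * (y + 1)) ⇔ (i < j)
left-of-second i j y j<y = mk⇔ (λ le → ≰⇒> (λ j≤i → <⇒≱ (too-small j≤i) le)) large-enough
  where
  open ≤-Reasoning
  too-small : j ≤ i → j * (y + 1) < suc i * y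
  too-small j≤i = begin-strict
    j * (y + 1)  ≡⟨ *-+1 j y ⟩
    j * y + j    <⟨ +-monoʳ-< (j * y) j<y ⟩
    j * y + y    ≡⟨ +-comm (j * y) y ⟩
    suc j * y    ≤⟨ *-monoˡ-≤ y (s≤s j≤i) ⟩
    suc i * y    ∎
  large-enough : i < j → suc i * y ≤ j * (y + 1)
  large-enough i<j = begin
    suc i * y    ≤⟨ *-monoˡ-≤ y i<j ⟩
    j * y        ≤⟨ *-monoʳ-≤ j (m≤m+n y 1) ⟩
    j * (y + 1)  ∎

second-left-of : ∀ i j y → j < y → (suc j * (y + 1) ≤ i * y) ⇔ (suc j < i)
second-left-of i j y j<y = mk⇔ (λ le → ≰⇒> (λ i≤j+1 → <⇒≱ (too-small i≤j+1) le)) large-enough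
  where
  open ≤-Reasoning
  too-small : i ≤ suc j → i * y < suc j * (y + 1)
  too-small i≤j+1 = begin-strict
    i * y                ≤⟨ *-monoˡ-≤ y i≤j+1 ⟩
    suc j * y            <⟨ m<m+n (suc j * y) (s≤s z≤n) ⟩
    suc j * y + suc j    ≡⟨ *-+1 (suc j) y ⟨
    suc j * (y + 1)      ∎
  large-enough : suc j < i → suc j * (y + 1) ≤ i * y
  large-enough j+1<i = begin
    suc j * (y + 1)      ≡⟨ *-+1 (suc j) y ⟩
    suc j * y + suc j    ≤⟨ +-monoʳ-≤ (suc j * y) j<y ⟩
    suc j * y + y        ≡⟨ +-comm (suc j * y) y ⟩
    suc (suc j) * y      ≤⟨ *-monoˡ-≤ y j+1<i ⟩
    i * y                ∎

squeezed : ∀ i j → (¬ i < j × ¬ suc j < i) ⇔ (i ≡ j ⊎ i ≡ suc j)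
squeezed i j = mk⇔ pin bounds
  where
  pin : ¬ i < j × ¬ suc j < i → i ≡ j ⊎ i ≡ suc j
  pin (i≮j , i≯j+1) with m≤n⇒m<n∨m≡n (≮⇒≥ i≮j)
  ... | inj₁ j<i = inj₂ (≤-antisym (≮⇒≥ i≯j+1) j<i)
  ... | inj₂ j≡i = inj₁ (sym j≡i)
  bounds : i ≡ j ⊎ i ≡ suc j → ¬ i < j × ¬ suc j < i
  bounds (inj₁ refl) = n≮n i , λ j+1<j → n≮n j (<-trans (n<1+n j) j+1<j)
  bounds (inj₂ refl) = (λ j+1<j → n≮n j (<-trans (n<1+n j) j+1<j)) , n≮n i

data ParityView : ℕ → Set where
  even : ∀ q → ParityView (2 * q)
  odd  : ∀ q → ParityView (suc (2 * q))

parityView : ∀ n → ParityView n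
parityView zero = even 0
parityView (suc n) with parityView n
... | even q = odd q
... | odd q  = subst ParityView (*-suc 2 q) (even (suc q))

even-not-consecutive : ∀ a b → ¬ Consecutive (2 * a) (2 * b)
even-not-consecutive a b (inj₁ e) = even≢odd b a (sym e)
even-not-consecutive a b (inj₂ e) = even≢odd a b (sym e)

odd-not-consecutive : ∀ a b → ¬ Consecutive (suc (2 * a)) (suc (2 * b))
odd-not-consecutive a b (inj₁ e) = even-not-consecutive a b (inj₁ (suc-injective e))
odd-not-consecutive a b (inj₂ e) = even-not-consecutive a b (inj₂ (suc-injective e))

even-odd-consecutive : ∀ a b → Consecutive (2 * a) (suc (2 * b)) ⇔ (a ≡ b ⊎ a ≡ suc b)
even-odd-consecutive a b = mk⇔ halve double
  where
  halve : Consecutive (2 * a) (suc (2 * b)) → a ≡ b ⊎ a ≡ suc b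
  halve (inj₁ e) = inj₁ (*-cancelˡ-≡ a b 2 (suc-injective e))
  halve (inj₂ e) = inj₂ (*-cancelˡ-≡ a (suc b) 2 (trans (sym e) (sym (*-suc 2 b))))
  double : a ≡ b ⊎ a ≡ suc b → Consecutive (2 * a) (suc (2 * b))
  double (inj₁ refl) = inj₁ refl
  double (inj₂ refl) = inj₂ (sym (*-suc 2 b))

-- From now on x = y + 1; the elements are Aᵢ = inj₁ i and Bⱼ = inj₂ j.
module IntervalOrder (y : ℕ) .{{_ : NonZero y}} .{{_ : NonZero (y + 1)}} where

  Incomparable : Elem (y + 1) y → Elem (y + 1) y → Set
  Incomparable = IncompEdge (y + 1) y

  cross-incomparable : ∀ i j → Incomparable (inj₁ i) (inj₂ j) ⇔ (toℕ i ≡ toℕ j ⊎ toℕ i ≡ suc (toℕ j))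
  cross-incomparable i j = ⇔.trans (mk⇔ orders unordered) (squeezed (toℕ i) (toℕ j))
    where
    j<y : toℕ j < y
    j<y = toℕ<n j
    A<B⇔ : Below (y + 1) y (inj₁ i) (inj₂ j) ⇔ toℕ i < toℕ j
    A<B⇔ = ⇔.trans (fraction-≤ (suc (toℕ i)) (toℕ j) (y + 1) y) (left-of-second (toℕ i) (toℕ j) y j<y)
    B<A⇔ : Below (y + 1) y (inj₂ j) (inj₁ i) ⇔ suc (toℕ j) < toℕ i
    B<A⇔ = ⇔.trans (fraction-≤ (suc (toℕ j)) (toℕ i) y (y + 1)) (second-left-of (toℕ i) (toℕ j) y j<y)
    orders : Incomparable (inj₁ i) (inj₂ j) → ¬ toℕ i < toℕ j × ¬ suc (toℕ j) < toℕ i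
    orders (_ , A≮B , B≮A) = A≮B ∘ from A<B⇔ , B≮A ∘ from B<A⇔
    unordered : ¬ toℕ i < toℕ j × ¬ suc (toℕ j) < toℕ i → Incomparable (inj₁ i) (inj₂ j)
    unordered (i≮j , i≯j+1) = (λ ()) , i≮j ∘ to A<B⇔ , i≯j+1 ∘ to B<A⇔

  label : Elem (y + 1) y → ℕ
  label (inj₁ i) = 2 * toℕ i
  label (inj₂ j) = suc (2 * toℕ j)

  label<n : ∀ u → label u < suc (2 * y)
  label<n (inj₁ i) = s≤s (*-monoʳ-≤ 2 (m<1+n⇒m≤n (subst (toℕ i <_) (+-comm y 1) (toℕ<n i))))
  label<n (inj₂ j) = s≤s (*-monoʳ-< 2 (toℕ<n j))

  label-injective : ∀ u v → label u ≡ label v → u ≡ v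
  label-injective (inj₁ i) (inj₁ i′) e = cong inj₁ (toℕ-injective (*-cancelˡ-≡ (toℕ i) (toℕ i′) 2 e))
  label-injective (inj₁ i) (inj₂ j)  e = contradiction e (even≢odd (toℕ i) (toℕ j))
  label-injective (inj₂ j) (inj₁ i)  e = contradiction (sym e) (even≢odd (toℕ i) (toℕ j))
  label-injective (inj₂ j) (inj₂ j′) e =
    cong inj₂ (toℕ-injective (*-cancelˡ-≡ (toℕ j) (toℕ j′) 2 (suc-injective e)))

  half-even : ∀ q → 2 * q < suc (2 * y) → q < y + 1
  half-even q 2q<n = subst (q <_) (+-comm 1 y) (s≤s (*-cancelˡ-≤ {q} {y} 2 (m<1+n⇒m≤n 2q<n)))

  half-odd : ∀ q → suc (2 * q) < suc (2 * y) → q < y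
  half-odd q 2q+1<n = *-cancelˡ-< 2 q y (m<1+n⇒m≤n 2q+1<n)

  unlabel : ∀ m → m < suc (2 * y) → Elem (y + 1) y
  unlabel m m<n with parityView m
  ... | even q = inj₁ (fromℕ< (half-even q m<n))
  ... | odd q  = inj₂ (fromℕ< (half-odd q m<n))

  label-unlabel : ∀ m (m<n : m < suc (2 * y)) → label (unlabel m m<n) ≡ m
  label-unlabel m m<n with parityView m
  ... | even q = cong (2 *_) (toℕ-fromℕ< (half-even q m<n))
  ... | odd q  = cong (suc ∘ (2 *_)) (toℕ-fromℕ< (half-odd q m<n))

  adjacency : ∀ u v → Incomparable u v ⇔ Consecutive (label u) (label v)
  adjacency (inj₁ i) (inj₁ i′) =
    mk⇔ (⊥-elim ∘ first-family-comparable (y + 1) y i i′) (⊥-elim ∘ even-not-consecutive (toℕ i) (toℕ i′))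
  adjacency (inj₂ j) (inj₂ j′) =
    mk⇔ (⊥-elim ∘ second-family-comparable (y + 1) y j j′) (⊥-elim ∘ odd-not-consecutive (toℕ j) (toℕ j′))
  adjacency (inj₁ i) (inj₂ j) =
    ⇔.trans (cross-incomparable i j) (⇔.sym (even-odd-consecutive (toℕ i) (toℕ j)))
  adjacency (inj₂ j) (inj₁ i) =
    ⇔.trans (incomparable-sym (y + 1) y (inj₂ j) (inj₁ i))
      (⇔.trans (adjacency (inj₁ i) (inj₂ j)) (mk⇔ Consecutive-sym Consecutive-sym))

  pathLabelling : PathLabelling (suc (2 * y)) Incomparable
  pathLabelling = record
    { label           = label
    ; label<n         = label<n
    ; label-injective = label-injective
    ; unlabel         = unlabel
    ; label-unlabel   = label-unlabel
    ; adjacency       = adjacency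
    }

-- The incomparability graph is a path on 2y + 1 vertices.
lemma12 : (x y : ℕ) .{{_ : NonZero x}} .{{_ : NonZero y}} → y ≤ x → 2 ≤ y → x ≡ y + 1 →
            ∃ λ n → Odd n × IsPathOn n (IncompEdge x y)
lemma12 .(y + 1) y _ _ refl =
  suc (2 * y) , (y , refl) , labelling⇒path (IntervalOrder.pathLabelling y)
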